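{- Let $D$ be a finite set. Let $t \ge 1$ be real. Let $\alpha_x \ge 0$ for each $x \in D$. Let $\lvert\bm x\rvert$ denote the number of distinct elements in $\bm x$. Let $\tau \colon \mathbb{N}_{\ge 0} \to \mathbb{R}_{\ge 0}$ be some non-increasing function. Then \[ \mathop{\mathbb{E}}_{\bm x \in D^k} \left[ \tau(\lvert\bm x\rvert) \right] \mathop{\mathbb{E}}_{\bm x \in D^k} \left[\prod_{i=1}^k \alpha_{x_i}\right] \le \mathop{\mathbb{E}}_{\bm x \in D^k} \left[ \tau(\lvert\bm x\rvert) \prod_{i=1}^k \alpha_{x_i}\right]. \]
   Context: $k$ is a nonnegative integer and the expectations are over a uniformly random $\bm x=(x_1,\dots,x_k)\in D^k$. -}

module Defs where

open import Level using (Level; _⊔_) renaming (suc to lsuc)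
open import Data.Nat using (ℕ; zero; suc) renaming (_^_ to _^ℕ_)
open import Data.Fin using (Fin; _≟_)
open import Data.Vec using (Vec; []; _∷_; toList)
open import Data.List using (length; deduplicate)
open import Relation.Nullary using (¬_)
open import Relation.Binary using (Rel; IsTotalOrder)
open import Algebra.Bundles using (CommutativeRing)

-- An ordered field (the real numbers are an instance).  The multiplicative
-- inverse is a total function; its value at 0 is unconstrained (junk).
record OrderedField (c ℓ₁ ℓ₂ : Level) : Set (lsuc (c ⊔ ℓ₁ ⊔ ℓ₂)) where
  field
    commutativeRing : CommutativeRing c ℓ₁
  open CommutativeRing commutativeRing public
  infix 4 _≤_
  infix 8 _⁻¹
  field
    _≤_          : Rel Carrier ℓ₂
    isTotalOrder : IsTotalOrder _≈_ _≤_
    +-mono-≤     : ∀ {a b} d → a ≤ b → a + d ≤ b + d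
    *-nonneg     : ∀ {a b} → 0# ≤ a → 0# ≤ b → 0# ≤ a * b
    0≉1          : ¬ (0# ≈ 1#)
    _⁻¹          : Carrier → Carrier
    ⁻¹-inverse   : ∀ x → ¬ (x ≈ 0#) → x * (x ⁻¹) ≈ 1#

module _ {c ℓ₁ ℓ₂} (F : OrderedField c ℓ₁ ℓ₂) where
  open OrderedField F

  fromℕ : ℕ → Carrier
  fromℕ zero    = 0#
  fromℕ (suc m) = 1# + fromℕ m

  sumFin : (n : ℕ) → (Fin n → Carrier) → Carrier
  sumFin zero    f = 0#
  sumFin (suc n) f = f Fin.zero + sumFin n (λ j → f (Fin.suc j))

  sumTuples : (n k : ℕ) → (Vec (Fin n) k → Carrier) → Carrier
  sumTuples n zero    f = f []
  sumTuples n (suc k) f = sumFin n (λ j → sumTuples n k (λ xs → f (j ∷ xs)))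

  𝔼 : (n k : ℕ) → (Vec (Fin n) k → Carrier) → Carrier
  𝔼 n k f = sumTuples n k f * (fromℕ (n ^ℕ k)) ⁻¹

  prodα : ∀ {n k} → (Fin n → Carrier) → Vec (Fin n) k → Carrier
  prodα α []       = 1#
  prodα α (x ∷ xs) = α x * prodα α xs

distinct : ∀ {n k} → Vec (Fin n) k → ℕ
distinct xs = length (deduplicate _≟_ (toList xs))

-- After clearing denominators the claim reads (Σα)^k · Σₓ τ(|x|) ≤ n^k · W(α), where
-- W(β) = Σₓ τ(|x|) ∏ᵢ β(xᵢ); for the constant weight μ = Σα / n both sides agree, so it suffices
-- that W(μ, …, μ) ≤ W(α).  W does not increase under a Robin Hood transfer between two coordinates
-- a, b (new values inside [β a, β b], same sum).  Indeed, replacing b by a in a tuple x lowers |x| by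
-- one exactly when both occur, so with Δ m = τ m − τ (m + 1) ≥ 0,
--   W(β) + Z = C + Σ_x̂ Δ(|x̂|) R(x̂) (β a ^ r(x̂) + β b ^ r(x̂)),
-- a sum over merged tuples x̂ with r(x̂) the number of a's in x̂, where Z, C and R ≥ 0 depend only on
-- β a + β b and on β off {a, b}; and u^r + v^r decreases when (u, v) moves inwards with fixed sum.
-- One transfer per coordinate moves α to the constant weight.
module Submission where

open import Defs
open import Data.Nat using (ℕ)
import Data.Nat
open import Data.Fin using (Fin)

open import Algebra.Bundles using (CommutativeMonoid)
import Algebra.Properties.CommutativeMonoid.Sum as MonoidSum
import Algebra.Properties.CommutativeSemigroup as CommutativeSemigroupProperties
open import Data.Bool using (Bool; true; false; _∨_; _∧_; if_then_else_)
import Data.Bool.Properties as Bool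
open import Data.Empty using (⊥-elim)
open import Data.Fin using (zero; suc; _≟_)
open import Data.List as List using (List; []; _∷_; length; deduplicate; allFin)
import Data.List.Membership.DecPropositional as DecMembership
open import Data.List.Membership.Propositional using (_∈_; _∉_; find)
open import Data.List.Membership.Propositional.Properties using (∈-deduplicate⁻; ∈-deduplicate⁺; ∈-allFin)
import Data.List.Relation.Unary.All as All
open import Data.List.Relation.Unary.All.Properties using (All¬⇒¬Any)
open import Data.List.Relation.Unary.AllPairs using ([]; _∷_)
open import Data.List.Relation.Unary.Any using (here; there)
open import Data.List.Relation.Unary.Unique.DecPropositional.Properties using (deduplicate-!)
open import Data.List.Relation.Unary.Unique.Propositional using (Unique)
open import Data.Nat using (zero; suc)
import Data.Nat as ℕ
import Data.Nat.Properties as ℕₚ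
open import Data.Product using (Σ-syntax; _×_; _,_; proj₁; proj₂)
open import Data.Sum as Sum using (_⊎_; inj₁; inj₂)
open import Data.Vec as Vec using (Vec; []; _∷_; toList)
open import Data.Vec.Functional using (Vector; updateAt)
open import Data.Vec.Functional.Properties using (updateAt-updates; updateAt-minimal)
open import Data.Vec.Properties using (toList-map)
open import Function using (const; _∘_; mk⇔)
open import Level using (_⊔_)
open import Relation.Binary using (IsTotalOrder; Poset)
open import Relation.Binary.PropositionalEquality as ≡ using (_≡_; _≢_; _≗_)
open import Relation.Nullary using (¬_; does; yes; no)
open import Relation.Nullary.Decidable using (dec-true; dec-false; does-⇔)

module PairedSums {c ℓ} (M : CommutativeMonoid c ℓ) where
  open CommutativeMonoid M renaming (_∙_ to _+_; ε to 0#; ∙-cong to +-cong; ∙-congˡ to +-congˡ)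
  open MonoidSum M using (sum)
  open CommutativeSemigroupProperties commutativeSemigroup using (x∙yz≈y∙xz)
  open import Relation.Binary.Reasoning.Setoid setoid

  zeroAt : ∀ {n} → Fin n → Vector Carrier n → Vector Carrier n
  zeroAt i f = updateAt f i (const 0#)

  sum-zeroAt : ∀ {n} (f : Vector Carrier n) i → sum f ≈ f i + sum (zeroAt i f)
  sum-zeroAt f zero    = +-congˡ (sym (identityˡ _))
  sum-zeroAt f (suc i) = begin
    f zero + sum (λ j → f (suc j))
      ≈⟨ +-congˡ (sum-zeroAt (λ j → f (suc j)) i) ⟩
    f zero + (f (suc i) + sum (zeroAt i (λ j → f (suc j))))
      ≈⟨ x∙yz≈y∙xz _ _ _ ⟩
    f (suc i) + (f zero + sum (zeroAt i (λ j → f (suc j)))) ∎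

  module _ {n : ℕ} {a b : Fin n} (a≢b : a ≢ b) where

    zeroAt₂ : Vector Carrier n → Vector Carrier n
    zeroAt₂ f = zeroAt b (zeroAt a f)

    sum-pair-split : (f : Vector Carrier n) → sum f ≈ (f a + f b) + sum (zeroAt₂ f)
    sum-pair-split f = begin
      sum f                                         ≈⟨ sum-zeroAt f a ⟩
      f a + sum (zeroAt a f)                        ≈⟨ +-congˡ (sum-zeroAt (zeroAt a f) b) ⟩
      f a + (zeroAt a f b + sum (zeroAt₂ f))        ≡⟨ ≡.cong (λ x → f a + (x + sum (zeroAt₂ f)))
                                                         (updateAt-minimal b a f (λ b≡a → a≢b (≡.sym b≡a))) ⟩
      f a + (f b + sum (zeroAt₂ f))                 ≈⟨ sym (assoc _ _ _) ⟩
      (f a + f b) + sum (zeroAt₂ f)                 ∎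

    zeroAt₂-b : ∀ f → zeroAt₂ f b ≡ 0#
    zeroAt₂-b f = updateAt-updates b (zeroAt a f)

    zeroAt₂-a : ∀ f → zeroAt₂ f a ≡ 0#
    zeroAt₂-a f = ≡.trans (updateAt-minimal a b (zeroAt a f) a≢b) (updateAt-updates a f)

    zeroAt₂-off : ∀ f {j} → j ≢ a → j ≢ b → zeroAt₂ f j ≡ f j
    zeroAt₂-off f {j} j≢a j≢b = ≡.trans (updateAt-minimal j b (zeroAt a f) j≢b) (updateAt-minimal j a f j≢a)

    zeroAt₂-cong : ∀ {f g : Vector Carrier n} → (∀ j → j ≢ a → j ≢ b → f j ≈ g j) →
                   ∀ j → zeroAt₂ f j ≈ zeroAt₂ g j
    zeroAt₂-cong {f} {g} f≈g j with j ≟ a | j ≟ b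
    ... | yes ≡.refl | _          = reflexive (≡.trans (zeroAt₂-a f) (≡.sym (zeroAt₂-a g)))
    ... | no _       | yes ≡.refl = reflexive (≡.trans (zeroAt₂-b f) (≡.sym (zeroAt₂-b g)))
    ... | no j≢a     | no j≢b     = begin
      zeroAt₂ f j  ≡⟨ zeroAt₂-off f j≢a j≢b ⟩
      f j          ≈⟨ f≈g j j≢a j≢b ⟩
      g j          ≡⟨ zeroAt₂-off g j≢a j≢b ⟨
      zeroAt₂ g j  ∎

    sum-pair : ∀ {f g : Vector Carrier n} → (∀ j → j ≢ a → j ≢ b → f j ≈ g j) →
               f a + f b ≈ g a + g b → sum f ≈ sum g
    sum-pair {f} {g} f≈g pair = begin
      sum f                          ≈⟨ sum-pair-split f ⟩
      (f a + f b) + sum (zeroAt₂ f)  ≈⟨ +-cong pair (MonoidSum.sum-cong-≋ M (zeroAt₂-cong f≈g)) ⟩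
      (g a + g b) + sum (zeroAt₂ g)  ≈⟨ sym (sum-pair-split g) ⟩
      sum g                          ∎

indicator : Bool → ℕ
indicator p = if p then 1 else 0

indicator-∨-∧ : ∀ p q → indicator p ℕ.+ indicator q ≡ indicator (p ∨ q) ℕ.+ indicator (p ∧ q)
indicator-∨-∧ false false = ≡.refl
indicator-∨-∧ false true  = ≡.refl
indicator-∨-∧ true  false = ≡.refl
indicator-∨-∧ true  true  = ≡.refl

open MonoidSum ℕₚ.+-0-commutativeMonoid using () renaming (sum to sumℕ; sum-cong-≗ to sumℕ-cong)

count : ∀ {n} → (Fin n → Bool) → ℕ
count S = sumℕ (λ j → indicator (S j))

count-cong : ∀ {n} {S T : Fin n → Bool} → S ≗ T → count S ≡ count T
count-cong S≗T = sumℕ-cong (λ j → ≡.cong indicator (S≗T j))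

count-insert : ∀ {n} (y : Fin n) (T : Fin n → Bool) → T y ≡ false →
               count (λ j → does (j ≟ y) ∨ T j) ≡ ℕ.suc (count T)
count-insert zero    T Ty≡false rewrite Ty≡false = ≡.refl
count-insert (suc y) T Ty≡false = ≡.trans
  (≡.cong (indicator (T zero) ℕ.+_) (count-insert y (λ j → T (suc j)) Ty≡false))
  (ℕₚ.+-suc (indicator (T zero)) _)

module _ {n : ℕ} where
  open DecMembership (_≟_ {n}) using (_∈?_)

  occurs : List (Fin n) → Fin n → Bool
  occurs L j = does (j ∈? L)

  length-unique : ∀ {L} → Unique L → length L ≡ count (occurs L)
  length-unique []                       = ≡.sym (MonoidSum.sum-replicate-zero ℕₚ.+-0-commutativeMonoid n)
  length-unique {y ∷ ys} (y∉ys ∷ unique) = ≡.trans (≡.cong ℕ.suc (length-unique unique))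
    (≡.sym (count-insert y (occurs ys) (dec-false (y ∈? ys) (All¬⇒¬Any y∉ys))))

  occurs-deduplicate : ∀ L → occurs (deduplicate _≟_ L) ≗ occurs L
  occurs-deduplicate L j =
    does-⇔ (mk⇔ (∈-deduplicate⁻ _≟_ L) (∈-deduplicate⁺ _≟_)) (j ∈? deduplicate _≟_ L) (j ∈? L)

  distinct≡count-occurs : ∀ {k} (x : Vec (Fin n) k) → distinct x ≡ count (occurs (toList x))
  distinct≡count-occurs x = ≡.trans (length-unique (deduplicate-! _≟_ (toList x)))
                                    (count-cong (occurs-deduplicate (toList x)))

module Merge {n : ℕ} {a b : Fin n} (a≢b : a ≢ b) where
  open CommutativeSemigroupProperties (CommutativeMonoid.commutativeSemigroup Bool.∨-commutativeMonoid)
    using () renaming (interchange to ∨-interchange)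

  merge : Fin n → Fin n
  merge j = if does (j ≟ b) then a else j

  merged : (Fin n → Bool) → Fin n → Bool
  merged S j = if does (j ≟ b) then false else if does (j ≟ a) then S a ∨ S b else S j

  merged-∨ : ∀ S T j → merged (λ i → S i ∨ T i) j ≡ merged S j ∨ merged T j
  merged-∨ S T j with does (j ≟ b) | does (j ≟ a)
  ... | true  | _     = ≡.refl
  ... | false | true  = ∨-interchange (S a) (T a) (S b) (T b)
  ... | false | false = ≡.refl

  merge≢b : ∀ y → merge y ≢ b
  merge≢b y with y ≟ b
  ... | yes _   = a≢b
  ... | no y≢b  = y≢b

  merged-≟ : ∀ y j → does (j ≟ merge y) ≡ merged (λ i → does (i ≟ y)) j
  merged-≟ y j with j ≟ b | j ≟ a
  ... | yes j≡b | _       = dec-false (j ≟ merge y) (λ j≡y′ → merge≢b y (≡.trans (≡.sym j≡y′) j≡b))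
  ... | no _    | yes j≡a with y ≟ b
  ...   | yes y≡b = ≡.trans (dec-true (j ≟ a) j≡a)
                    (≡.sym (≡.trans (≡.cong (does (a ≟ y) ∨_) (dec-true (b ≟ y) (≡.sym y≡b))) (Bool.∨-zeroʳ _)))
  ...   | no y≢b  = ≡.trans (≡.cong (λ i → does (i ≟ y)) j≡a)
                    (≡.sym (≡.trans (≡.cong (does (a ≟ y) ∨_) (dec-false (b ≟ y) (λ b≡y → y≢b (≡.sym b≡y))))
                                    (Bool.∨-identityʳ _)))
  merged-≟ y j | no j≢b | no j≢a with y ≟ b
  ...   | yes y≡b = ≡.trans (dec-false (j ≟ a) j≢a) (≡.sym (dec-false (j ≟ y) (λ j≡y → j≢b (≡.trans j≡y y≡b))))
  ...   | no _    = ≡.refl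

  occurs-map-merge : ∀ L j → occurs (List.map merge L) j ≡ merged (occurs L) j
  occurs-map-merge [] j with does (j ≟ b) | does (j ≟ a)
  ... | true  | _     = ≡.refl
  ... | false | true  = ≡.refl
  ... | false | false = ≡.refl
  occurs-map-merge (y ∷ ys) j = ≡.trans (≡.cong₂ _∨_ (merged-≟ y j) (occurs-map-merge ys j))
                                        (≡.sym (merged-∨ (λ i → does (i ≟ y)) (occurs ys) j))

  merged-a : ∀ S → merged S a ≡ S a ∨ S b
  merged-a S rewrite dec-false (a ≟ b) a≢b | dec-true (a ≟ a) ≡.refl = ≡.refl

  merged-b : ∀ S → merged S b ≡ false
  merged-b S rewrite dec-true (b ≟ b) ≡.refl = ≡.refl

  merged-off : ∀ S {j} → j ≢ a → j ≢ b → merged S j ≡ S j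
  merged-off S {j} j≢a j≢b rewrite dec-false (j ≟ b) j≢b | dec-false (j ≟ a) j≢a = ≡.refl

  count-merged : ∀ S → count S ≡ count (merged S) ℕ.+ indicator (S a ∧ S b)
  count-merged S = begin
    count S                                               ≡⟨ ℕSums.sum-pair-split a≢b (indicator ∘ S) ⟩
    (indicator (S a) ℕ.+ indicator (S b)) ℕ.+ rest S      ≡⟨ ≡.cong (ℕ._+ rest S) (indicator-∨-∧ (S a) (S b)) ⟩
    (indicator (S a ∨ S b) ℕ.+ indicator (S a ∧ S b)) ℕ.+ rest S
      ≡⟨ CommutativeSemigroupProperties.xy∙z≈xz∙y ℕₚ.+-commutativeSemigroup
           (indicator (S a ∨ S b)) (indicator (S a ∧ S b)) (rest S) ⟩
    (indicator (S a ∨ S b) ℕ.+ rest S) ℕ.+ indicator (S a ∧ S b)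
      ≡⟨ ≡.cong (ℕ._+ indicator (S a ∧ S b)) (≡.sym merged-split) ⟩
    count (merged S) ℕ.+ indicator (S a ∧ S b)            ∎
    where
    open ≡.≡-Reasoning
    module ℕSums = PairedSums ℕₚ.+-0-commutativeMonoid
    rest : (Fin n → Bool) → ℕ
    rest T = sumℕ (ℕSums.zeroAt₂ a≢b (indicator ∘ T))
    merged-split : count (merged S) ≡ indicator (S a ∨ S b) ℕ.+ rest S
    merged-split = begin
      count (merged S)  ≡⟨ ℕSums.sum-pair-split a≢b (indicator ∘ merged S) ⟩
      (indicator (merged S a) ℕ.+ indicator (merged S b)) ℕ.+ rest (merged S)
        ≡⟨ ≡.cong₂ (λ p q → (indicator p ℕ.+ indicator q) ℕ.+ rest (merged S)) (merged-a S) (merged-b S) ⟩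
      (indicator (S a ∨ S b) ℕ.+ 0) ℕ.+ rest (merged S)
        ≡⟨ ≡.cong₂ ℕ._+_ (ℕₚ.+-identityʳ _) (sumℕ-cong (ℕSums.zeroAt₂-cong a≢b
             (λ j j≢a j≢b → ≡.cong indicator (merged-off S j≢a j≢b)))) ⟩
      indicator (S a ∨ S b) ℕ.+ rest S ∎

  distinct-merge : ∀ {k} (x : Vec (Fin n) k) →
    distinct x ≡ distinct (Vec.map merge x) ℕ.+ indicator (occurs (toList x) a ∧ occurs (toList x) b)
  distinct-merge x = begin
    distinct x                                  ≡⟨ distinct≡count-occurs x ⟩
    count S                                     ≡⟨ count-merged S ⟩
    count (merged S) ℕ.+ both                   ≡⟨ ≡.cong (ℕ._+ both) (count-cong occurs-merge) ⟨
    count (occurs (toList (Vec.map merge x))) ℕ.+ both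
                                                ≡⟨ ≡.cong (ℕ._+ both) (distinct≡count-occurs (Vec.map merge x)) ⟨
    distinct (Vec.map merge x) ℕ.+ both         ∎
    where
    open ≡.≡-Reasoning
    S = occurs (toList x)
    both = indicator (S a ∧ S b)
    occurs-merge : occurs (toList (Vec.map merge x)) ≗ merged S
    occurs-merge j = ≡.trans (≡.cong (λ L → occurs L j) (toList-map merge x)) (occurs-map-merge (toList x) j)

module OrderedFieldProperties {c ℓ₁ ℓ₂} (F : OrderedField c ℓ₁ ℓ₂) where
  open OrderedField F hiding (zero) renaming (+-mono-≤ to +-monoˡ-≤)
  open IsTotalOrder isTotalOrder using (total; antisym; ≤-respʳ-≈; ≤-respˡ-≈)
    renaming (refl to ≤-refl; trans to ≤-trans; reflexive to ≤-reflexive)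
  open import Algebra.Properties.Ring ring using (-‿distribˡ-*; -‿distribʳ-*; -‿involutive)
  open import Algebra.Properties.Group +-group
    using () renaming (//-rightDividesˡ to [y-x]+x≈y; //-rightDividesʳ to [y+x]-x≈y)
  open import Algebra.Properties.Semiring.Exp semiring using (_^_; ^-congˡ)
  open import Algebra.Properties.CommutativeSemiring.Exp commutativeSemiring using (^-distrib-*)
  open import Algebra.Solver.Ring.NaturalCoefficients.Default commutativeSemiring
  open import Algebra.Properties.CommutativeSemigroup *-commutativeSemigroup using (x∙yz≈y∙xz)
  open PairedSums +-commutativeMonoid using (zeroAt; zeroAt₂; zeroAt₂-a; zeroAt₂-b; zeroAt₂-off; sum-pair)

  poset : Poset c ℓ₁ ℓ₂
  poset = record { isPartialOrder = IsTotalOrder.isPartialOrder isTotalOrder }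

  open import Relation.Binary.Reasoning.PartialOrder poset

  x≤y⇒0≤y-x : ∀ {x y} → x ≤ y → 0# ≤ y - x
  x≤y⇒0≤y-x {x} {y} x≤y = begin
    0#     ≈⟨ -‿inverseʳ x ⟨
    x - x  ≤⟨ +-monoˡ-≤ (- x) x≤y ⟩
    y - x  ∎

  +-monoʳ-≤ : ∀ z {x y} → x ≤ y → z + x ≤ z + y
  +-monoʳ-≤ z {x} {y} x≤y = begin
    z + x  ≈⟨ +-comm z x ⟩
    x + z  ≤⟨ +-monoˡ-≤ z x≤y ⟩
    y + z  ≈⟨ +-comm y z ⟩
    z + y  ∎

  +-mono-≤ : ∀ {x y u v} → x ≤ y → u ≤ v → x + u ≤ y + v
  +-mono-≤ {y = y} {u} x≤y u≤v = ≤-trans (+-monoˡ-≤ u x≤y) (+-monoʳ-≤ y u≤v)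

  +-nonneg : ∀ {x y} → 0# ≤ x → 0# ≤ y → 0# ≤ x + y
  +-nonneg 0≤x 0≤y = ≤-respˡ-≈ (+-identityˡ 0#) (+-mono-≤ 0≤x 0≤y)

  x≤x+y : ∀ x {y} → 0# ≤ y → x ≤ x + y
  x≤x+y x 0≤y = ≤-respˡ-≈ (+-identityʳ x) (+-monoʳ-≤ x 0≤y)

  +-cancelʳ-≤ : ∀ z {x y} → x + z ≤ y + z → x ≤ y
  +-cancelʳ-≤ z {x} {y} x+z≤y+z = begin
    x            ≈⟨ [y+x]-x≈y z x ⟨
    (x + z) - z  ≤⟨ +-monoˡ-≤ (- z) x+z≤y+z ⟩
    (y + z) - z  ≈⟨ [y+x]-x≈y z y ⟩
    y            ∎

  x≤[x+y]-z : ∀ x {y z} → z ≤ y → x ≤ (x + y) - z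
  x≤[x+y]-z x {y} {z} z≤y = begin
    x            ≈⟨ [y+x]-x≈y z x ⟨
    (x + z) - z  ≤⟨ +-monoˡ-≤ (- z) (+-monoʳ-≤ x z≤y) ⟩
    (x + y) - z  ∎

  *-monoʳ-≤ : ∀ {z} → 0# ≤ z → ∀ {x y} → x ≤ y → x * z ≤ y * z
  *-monoʳ-≤ {z} 0≤z {x} {y} x≤y = +-cancelʳ-≤ (- (x * z)) (begin
    x * z - x * z         ≈⟨ -‿inverseʳ (x * z) ⟩
    0#                    ≤⟨ *-nonneg 0≤z (x≤y⇒0≤y-x x≤y) ⟩
    z * (y - x)           ≈⟨ *-comm z (y - x) ⟩
    (y - x) * z           ≈⟨ distribʳ z y (- x) ⟩
    y * z + (- x) * z     ≈⟨ +-congˡ (-‿distribˡ-* x z) ⟨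
    y * z - x * z         ∎)

  *-monoˡ-≤ : ∀ {z} → 0# ≤ z → ∀ {x y} → x ≤ y → z * x ≤ z * y
  *-monoˡ-≤ {z} 0≤z {x} {y} x≤y = ≤-respʳ-≈ (*-comm y z) (≤-respˡ-≈ (*-comm x z) (*-monoʳ-≤ 0≤z x≤y))

  *-mono-≤ : ∀ {x y u v} → 0# ≤ y → 0# ≤ u → x ≤ y → u ≤ v → x * u ≤ y * v
  *-mono-≤ 0≤y 0≤u x≤y u≤v = ≤-trans (*-monoʳ-≤ 0≤u x≤y) (*-monoˡ-≤ 0≤y u≤v)

  x*x-nonneg : ∀ x → 0# ≤ x * x
  x*x-nonneg x with total 0# x
  ... | inj₁ 0≤x = *-nonneg 0≤x 0≤x
  ... | inj₂ x≤0 = ≤-respʳ-≈ -x*-x≈x*x (*-nonneg 0≤-x 0≤-x)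
    where
    0≤-x : 0# ≤ - x
    0≤-x = ≤-respʳ-≈ (+-identityˡ (- x)) (x≤y⇒0≤y-x x≤0)
    -x*-x≈x*x : - x * - x ≈ x * x
    -x*-x≈x*x = trans (sym (-‿distribˡ-* x (- x)))
                      (trans (-‿cong (sym (-‿distribʳ-* x x))) (-‿involutive (x * x)))

  0≤1 : 0# ≤ 1#
  0≤1 = ≤-respʳ-≈ (*-identityˡ 1#) (x*x-nonneg 1#)

  ^-nonneg : ∀ {x} → 0# ≤ x → ∀ r → 0# ≤ x ^ r
  ^-nonneg 0≤x zero    = 0≤1
  ^-nonneg 0≤x (suc r) = *-nonneg 0≤x (^-nonneg 0≤x r)

  ^-monoˡ-≤ : ∀ {x y} → 0# ≤ x → x ≤ y → ∀ r → x ^ r ≤ y ^ r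
  ^-monoˡ-≤ 0≤x x≤y zero    = ≤-refl
  ^-monoˡ-≤ 0≤x x≤y (suc r) = *-mono-≤ (≤-trans 0≤x x≤y) (^-nonneg 0≤x r) x≤y (^-monoˡ-≤ 0≤x x≤y r)

  ^+^-transfer : ∀ {x d e} → 0# ≤ x → 0# ≤ d → 0# ≤ e → ∀ r →
                 (x + d) ^ r + (x + e) ^ r ≤ x ^ r + ((x + e) + d) ^ r
  ^+^-transfer _ _ _ zero = ≤-refl
  ^+^-transfer {x} {d} {e} 0≤x 0≤d 0≤e (suc r) = begin
    (x + d) * A + (x + e) * B       ≈⟨ solve 5 (λ x d e A B → (x :+ d) :* A :+ (x :+ e) :* B
                                                := x :* (A :+ B) :+ (d :* A :+ e :* B)) refl x d e A B ⟩
    x * (A + B) + (d * A + e * B)   ≤⟨ +-mono-≤ (*-monoˡ-≤ 0≤x (^+^-transfer 0≤x 0≤d 0≤e r))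
                                                (+-mono-≤ (*-monoˡ-≤ 0≤d A≤E) (*-monoˡ-≤ 0≤e B≤E)) ⟩
    x * (C + E) + (d * E + e * E)   ≈⟨ solve 5 (λ x d e C E → x :* (C :+ E) :+ (d :* E :+ e :* E)
                                                := x :* C :+ ((x :+ e) :+ d) :* E) refl x d e C E ⟩
    x * C + ((x + e) + d) * E       ∎
    where
    A = (x + d) ^ r
    B = (x + e) ^ r
    C = x ^ r
    E = ((x + e) + d) ^ r
    A≤E : A ≤ E
    A≤E = ^-monoˡ-≤ (+-nonneg 0≤x 0≤d) (+-monoˡ-≤ d (x≤x+y x 0≤e)) r
    B≤E : B ≤ E
    B≤E = ^-monoˡ-≤ (+-nonneg 0≤x 0≤e) (x≤x+y (x + e) 0≤d) r

  ^+^-spread : ∀ {x y u v} → 0# ≤ x → x ≤ u → x ≤ v → u + v ≈ x + y → ∀ r →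
               u ^ r + v ^ r ≤ x ^ r + y ^ r
  ^+^-spread {x} {y} {u} {v} 0≤x x≤u x≤v u+v≈x+y r = begin
    u ^ r + v ^ r                                    ≈⟨ +-cong (^-congˡ r (u≈ u)) (^-congˡ r (u≈ v)) ⟨
    (x + (u - x)) ^ r + (x + (v - x)) ^ r            ≤⟨ ^+^-transfer 0≤x (x≤y⇒0≤y-x x≤u) (x≤y⇒0≤y-x x≤v) r ⟩
    x ^ r + ((x + (v - x)) + (u - x)) ^ r            ≈⟨ +-congˡ (^-congˡ r y≈) ⟩
    x ^ r + y ^ r                                    ∎
    where
    u≈ : ∀ z → x + (z - x) ≈ z
    u≈ z = trans (+-comm x (z - x)) ([y-x]+x≈y x z)
    y≈ : (x + (v - x)) + (u - x) ≈ y
    y≈ = begin-equality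
      (x + (v - x)) + (u - x)  ≈⟨ +-congʳ (u≈ v) ⟩
      v + (u - x)              ≈⟨ +-assoc v u (- x) ⟨
      (v + u) - x              ≈⟨ +-congʳ (trans (+-comm v u) (trans u+v≈x+y (+-comm x y))) ⟩
      (y + x) - x              ≈⟨ [y+x]-x≈y x y ⟩
      y                        ∎

  open import Algebra.Properties.Semiring.Sum semiring
    using (sum; sum-cong-≋; ∑-distrib-+; *-distribˡ-sum; *-distribʳ-sum; sum-replicate)
  open import Algebra.Properties.Semiring.Mult semiring
    using (×-congʳ; ×-assoc-*; ×1-homo-*) renaming (_×_ to _·_)

  fromℕ≡·1# : ∀ m → fromℕ F m ≡ m · 1#
  fromℕ≡·1# zero    = ≡.refl
  fromℕ≡·1# (suc m) = ≡.cong (1# +_) (fromℕ≡·1# m)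

  sumFin≡sum : ∀ n (f : Fin n → Carrier) → sumFin F n f ≡ sum f
  sumFin≡sum zero    f = ≡.refl
  sumFin≡sum (suc n) f = ≡.cong (f zero +_) (sumFin≡sum n (λ j → f (suc j)))

  sum-const : ∀ n μ → sum {n} (λ _ → μ) ≈ fromℕ F n * μ
  sum-const n μ = begin-equality
    sum {n} (λ _ → μ)     ≈⟨ sum-replicate n ⟩
    n · μ                 ≈⟨ ×-congʳ n (*-identityˡ μ) ⟨
    n · (1# * μ)          ≈⟨ ×-assoc-* n 1# μ ⟨
    (n · 1#) * μ          ≡⟨ ≡.cong (_* μ) (fromℕ≡·1# n) ⟨
    fromℕ F n * μ         ∎

  fromℕ-* : ∀ m p → fromℕ F (m ℕ.* p) ≈ fromℕ F m * fromℕ F p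
  fromℕ-* m p = begin-equality
    fromℕ F (m ℕ.* p)      ≡⟨ fromℕ≡·1# (m ℕ.* p) ⟩
    (m ℕ.* p) · 1#         ≈⟨ ×1-homo-* m p ⟩
    (m · 1#) * (p · 1#)    ≡⟨ ≡.cong₂ _*_ (fromℕ≡·1# m) (fromℕ≡·1# p) ⟨
    fromℕ F m * fromℕ F p  ∎

  fromℕ-^ : ∀ m r → fromℕ F (m ℕ.^ r) ≈ fromℕ F m ^ r
  fromℕ-^ m zero    = +-identityʳ 1#
  fromℕ-^ m (suc r) = trans (fromℕ-* m (m ℕ.^ r)) (*-congˡ (fromℕ-^ m r))

  fromℕ-nonneg : ∀ m → 0# ≤ fromℕ F m
  fromℕ-nonneg zero    = ≤-refl
  fromℕ-nonneg (suc m) = +-nonneg 0≤1 (fromℕ-nonneg m)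

  fromℕ≉0 : ∀ {m} → m ≢ 0 → ¬ (fromℕ F m ≈ 0#)
  fromℕ≉0 {zero}  m≢0 _        = m≢0 ≡.refl
  fromℕ≉0 {suc m} _   1+m≈0 = 0≉1 (antisym 0≤1 (begin
    1#                ≤⟨ x≤x+y 1# (fromℕ-nonneg m) ⟩
    1# + fromℕ F m    ≈⟨ 1+m≈0 ⟩
    0#                ∎))

  ∃-mean : ∀ n (α : Fin n → Carrier) → Σ[ μ ∈ Carrier ] fromℕ F n * μ ≈ sum α
  ∃-mean zero    α = 0# , zeroˡ 0#
  ∃-mean (suc n) α = sum α * N ⁻¹ , (begin-equality
    N * (sum α * N ⁻¹)   ≈⟨ x∙yz≈y∙xz N (sum α) (N ⁻¹) ⟩
    sum α * (N * N ⁻¹)   ≈⟨ *-congˡ (⁻¹-inverse N (fromℕ≉0 {suc n} (λ ()))) ⟩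
    sum α * 1#           ≈⟨ *-identityʳ (sum α) ⟩
    sum α                ∎)
    where N = fromℕ F (suc n)

  sum-mono-≤ : ∀ {n} {f g : Fin n → Carrier} → (∀ j → f j ≤ g j) → sum f ≤ sum g
  sum-mono-≤ {zero}  f≤g = ≤-refl
  sum-mono-≤ {suc n} f≤g = +-mono-≤ (f≤g zero) (sum-mono-≤ (λ j → f≤g (suc j)))

  +-≤-≈⇒≈ : ∀ {x y u v} → x ≤ y → u ≤ v → x + u ≈ y + v → x ≈ y
  +-≤-≈⇒≈ {x} {y} {u} {v} x≤y u≤v x+u≈y+v = antisym x≤y (+-cancelʳ-≤ u (begin
    y + u  ≤⟨ +-monoʳ-≤ y u≤v ⟩
    y + v  ≈⟨ x+u≈y+v ⟨
    x + u  ∎))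

  sum-≤-≈⇒≈ : ∀ {n} {f g : Fin n → Carrier} → (∀ j → f j ≤ g j) → sum f ≈ sum g → ∀ j → f j ≈ g j
  sum-≤-≈⇒≈ {suc n} f≤g sum≈ zero    = +-≤-≈⇒≈ (f≤g zero) (sum-mono-≤ (λ j → f≤g (suc j))) sum≈
  sum-≤-≈⇒≈ {suc n} f≤g sum≈ (suc j) = sum-≤-≈⇒≈ (λ i → f≤g (suc i))
    (+-≤-≈⇒≈ (sum-mono-≤ (λ i → f≤g (suc i))) (f≤g zero) (trans (+-comm _ _) (trans sum≈ (+-comm _ _)))) j

  module _ {n : ℕ} where

    ∑ₜ : ∀ k → (Vec (Fin n) k → Carrier) → Carrier
    ∑ₜ = sumTuples F n

    ∑ₜ-suc : ∀ k (f : Vec (Fin n) (suc k) → Carrier) → ∑ₜ (suc k) f ≡ sum (λ j → ∑ₜ k (λ xs → f (j ∷ xs)))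
    ∑ₜ-suc k f = sumFin≡sum n _

    ∑ₜ-cong : ∀ k {f g : Vec (Fin n) k → Carrier} → (∀ x → f x ≈ g x) → ∑ₜ k f ≈ ∑ₜ k g
    ∑ₜ-cong zero    f≈g = f≈g []
    ∑ₜ-cong (suc k) {f} {g} f≈g = begin-equality
      ∑ₜ (suc k) f                               ≡⟨ ∑ₜ-suc k f ⟩
      sum (λ j → ∑ₜ k (λ xs → f (j ∷ xs)))       ≈⟨ sum-cong-≋ (λ j → ∑ₜ-cong k (λ xs → f≈g (j ∷ xs))) ⟩
      sum (λ j → ∑ₜ k (λ xs → g (j ∷ xs)))       ≡⟨ ∑ₜ-suc k g ⟨
      ∑ₜ (suc k) g                               ∎

    ∑ₜ-mono-≤ : ∀ k {f g : Vec (Fin n) k → Carrier} → (∀ x → f x ≤ g x) → ∑ₜ k f ≤ ∑ₜ k g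
    ∑ₜ-mono-≤ zero    f≤g = f≤g []
    ∑ₜ-mono-≤ (suc k) {f} {g} f≤g = begin
      ∑ₜ (suc k) f                               ≡⟨ ∑ₜ-suc k f ⟩
      sum (λ j → ∑ₜ k (λ xs → f (j ∷ xs)))       ≤⟨ sum-mono-≤ (λ j → ∑ₜ-mono-≤ k (λ xs → f≤g (j ∷ xs))) ⟩
      sum (λ j → ∑ₜ k (λ xs → g (j ∷ xs)))       ≡⟨ ∑ₜ-suc k g ⟨
      ∑ₜ (suc k) g                               ∎

    ∑ₜ-distrib-+ : ∀ k (f g : Vec (Fin n) k → Carrier) → ∑ₜ k (λ x → f x + g x) ≈ ∑ₜ k f + ∑ₜ k g
    ∑ₜ-distrib-+ zero    f g = refl
    ∑ₜ-distrib-+ (suc k) f g = begin-equality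
      ∑ₜ (suc k) (λ x → f x + g x)
        ≡⟨ ∑ₜ-suc k (λ x → f x + g x) ⟩
      sum (λ j → ∑ₜ k (λ xs → f (j ∷ xs) + g (j ∷ xs)))
        ≈⟨ sum-cong-≋ (λ j → ∑ₜ-distrib-+ k (λ xs → f (j ∷ xs)) (λ xs → g (j ∷ xs))) ⟩
      sum (λ j → ∑ₜ k (λ xs → f (j ∷ xs)) + ∑ₜ k (λ xs → g (j ∷ xs)))
        ≈⟨ ∑-distrib-+ (λ j → ∑ₜ k (λ xs → f (j ∷ xs))) (λ j → ∑ₜ k (λ xs → g (j ∷ xs))) ⟩
      sum (λ j → ∑ₜ k (λ xs → f (j ∷ xs))) + sum (λ j → ∑ₜ k (λ xs → g (j ∷ xs)))
        ≡⟨ ≡.cong₂ _+_ (∑ₜ-suc k f) (∑ₜ-suc k g) ⟨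
      ∑ₜ (suc k) f + ∑ₜ (suc k) g
        ∎

    *-distribˡ-∑ₜ : ∀ k z (f : Vec (Fin n) k → Carrier) → z * ∑ₜ k f ≈ ∑ₜ k (λ x → z * f x)
    *-distribˡ-∑ₜ zero    z f = refl
    *-distribˡ-∑ₜ (suc k) z f = begin-equality
      z * ∑ₜ (suc k) f                               ≡⟨ ≡.cong (z *_) (∑ₜ-suc k f) ⟩
      z * sum (λ j → ∑ₜ k (λ xs → f (j ∷ xs)))       ≈⟨ *-distribˡ-sum z (λ j → ∑ₜ k (λ xs → f (j ∷ xs))) ⟩
      sum (λ j → z * ∑ₜ k (λ xs → f (j ∷ xs)))       ≈⟨ sum-cong-≋ (λ j → *-distribˡ-∑ₜ k z (λ xs → f (j ∷ xs))) ⟩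
      sum (λ j → ∑ₜ k (λ xs → z * f (j ∷ xs)))       ≡⟨ ∑ₜ-suc k (λ x → z * f x) ⟨
      ∑ₜ (suc k) (λ x → z * f x)                     ∎

    ∑ₜ-distrib-*-+ : ∀ k (g f h : Vec (Fin n) k → Carrier) →
                     ∑ₜ k (λ x → g x * (f x + h x)) ≈ ∑ₜ k (λ x → g x * f x) + ∑ₜ k (λ x → g x * h x)
    ∑ₜ-distrib-*-+ k g f h =
      trans (∑ₜ-cong k (λ x → distribˡ (g x) (f x) (h x))) (∑ₜ-distrib-+ k (λ x → g x * f x) (λ x → g x * h x))

    ∑ₜ-prodα : ∀ k (β : Fin n → Carrier) → ∑ₜ k (prodα F β) ≈ sum β ^ k
    ∑ₜ-prodα zero    β = refl
    ∑ₜ-prodα (suc k) β = begin-equality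
      ∑ₜ (suc k) (prodα F β)                         ≡⟨ ∑ₜ-suc k (prodα F β) ⟩
      sum (λ j → ∑ₜ k (λ xs → β j * prodα F β xs))   ≈⟨ sum-cong-≋ (λ j → *-distribˡ-∑ₜ k (β j) (prodα F β)) ⟨
      sum (λ j → β j * ∑ₜ k (prodα F β))             ≈⟨ *-distribʳ-sum (∑ₜ k (prodα F β)) β ⟨
      sum β * ∑ₜ k (prodα F β)                       ≈⟨ *-congˡ (∑ₜ-prodα k β) ⟩
      sum β * sum β ^ k                              ∎

  zeroIf : Bool → Carrier → Carrier
  zeroIf p z = if p then 0# else z

  zeroIf-cong : ∀ p {w w′} → w ≈ w′ → zeroIf p w ≈ zeroIf p w′
  zeroIf-cong true  w≈w′ = refl
  zeroIf-cong false w≈w′ = w≈w′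

  *-zeroIf : ∀ z p w → z * zeroIf p w ≈ zeroIf p (z * w)
  *-zeroIf z true  w = zeroʳ z
  *-zeroIf z false w = refl

  prodα-cong : ∀ {n k} {β β′ : Fin n → Carrier} → (∀ j → β j ≈ β′ j) → (x : Vec (Fin n) k) →
               prodα F β x ≈ prodα F β′ x
  prodα-cong β≈β′ []       = refl
  prodα-cong β≈β′ (y ∷ ys) = *-cong (β≈β′ y) (prodα-cong β≈β′ ys)

  prodα-nonneg : ∀ {n k} {β : Fin n → Carrier} → (∀ j → 0# ≤ β j) → (x : Vec (Fin n) k) → 0# ≤ prodα F β x
  prodα-nonneg 0≤β []       = 0≤1
  prodα-nonneg 0≤β (y ∷ ys) = *-nonneg (0≤β y) (prodα-nonneg 0≤β ys)

  prodα-const : ∀ {n k} μ (x : Vec (Fin n) k) → prodα F (λ _ → μ) x ≈ μ ^ k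
  prodα-const μ []       = refl
  prodα-const μ (y ∷ ys) = *-congˡ (prodα-const μ ys)

  prodα-zeroAt : ∀ {n k} i (β : Fin n → Carrier) (x : Vec (Fin n) k) →
                 prodα F (zeroAt i β) x ≈ zeroIf (occurs (toList x) i) (prodα F β x)
  prodα-zeroAt i β []       = refl
  prodα-zeroAt i β (y ∷ ys) with i ≟ y
  ... | yes ≡.refl = trans (*-congʳ (reflexive (updateAt-updates i β))) (zeroˡ _)
  ... | no i≢y     = trans (*-cong (reflexive (updateAt-minimal y i β (λ y≡i → i≢y (≡.sym y≡i))))
                                   (prodα-zeroAt i β ys))
                           (*-zeroIf (β y) (occurs (toList ys) i) _)

  module Collapse {n : ℕ} {a b : Fin n} (a≢b : a ≢ b) where
    open Merge a≢b public using (merge; distinct-merge)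

    collapse : (Fin n → Carrier) → Carrier → Fin n → Carrier
    collapse β w j = if does (j ≟ a) then w else if does (j ≟ b) then 0# else β j

    collapse-cong : ∀ {β β′ w w′} → (∀ j → j ≢ a → j ≢ b → β′ j ≈ β j) → w′ ≈ w →
                    ∀ j → collapse β′ w′ j ≈ collapse β w j
    collapse-cong β′≈β w′≈w j with j ≟ a | j ≟ b
    ... | yes _   | _       = w′≈w
    ... | no _    | yes _   = refl
    ... | no j≢a  | no j≢b  = β′≈β j j≢a j≢b

    collapse-nonneg : ∀ {β w} → (∀ j → 0# ≤ β j) → 0# ≤ w → ∀ j → 0# ≤ collapse β w j
    collapse-nonneg 0≤β 0≤w j with does (j ≟ a) | does (j ≟ b)
    ... | true  | _     = 0≤w
    ... | false | true  = ≤-refl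
    ... | false | false = 0≤β j

    prodα-collapse : ∀ {k} β w (x : Vec (Fin n) k) →
                     prodα F (collapse β w) x ≈ w ^ Vec.count (_≟ a) x * prodα F (collapse β 1#) x
    prodα-collapse β w []       = sym (*-identityʳ 1#)
    prodα-collapse β w (y ∷ ys) with does (y ≟ a)
    ... | true  = trans (*-congˡ (prodα-collapse β w ys))
                        (solve 3 (λ w u R → w :* (u :* R) := (w :* u) :* (con 1 :* R)) refl w _ _)
    ... | false = trans (*-congˡ (prodα-collapse β w ys)) (x∙yz≈y∙xz _ _ _)

    sum-merge : ∀ β (h : Fin n → Carrier) →
                sum (λ y → β y * h (merge y)) ≈ sum (λ y → collapse β (β a + β b) y * h y)
    sum-merge β h = sum-pair a≢b off pair
      where
      β* = collapse β (β a + β b)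
      off : ∀ j → j ≢ a → j ≢ b → β j * h (merge j) ≈ β* j * h j
      off j j≢a j≢b rewrite dec-false (j ≟ a) j≢a | dec-false (j ≟ b) j≢b = refl
      pair : β a * h (merge a) + β b * h (merge b) ≈ β* a * h a + β* b * h b
      pair rewrite dec-false (a ≟ b) a≢b | dec-true (a ≟ a) ≡.refl | dec-true (b ≟ b) ≡.refl
                 | dec-false (b ≟ a) (λ b≡a → a≢b (≡.sym b≡a)) =
        trans (sym (distribʳ (h a) (β a) (β b))) (trans (sym (+-identityʳ _)) (+-congˡ (sym (zeroˡ (h b)))))

    ∑ₜ-merge : ∀ k (K : Vec (Fin n) k → Carrier) β →
               ∑ₜ k (λ x → K (Vec.map merge x) * prodα F β x)
                 ≈ ∑ₜ k (λ x̂ → K x̂ * prodα F (collapse β (β a + β b)) x̂)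
    ∑ₜ-merge zero    K β = refl
    ∑ₜ-merge (suc k) K β = begin-equality
      ∑ₜ (suc k) (λ x → K (Vec.map merge x) * prodα F β x)
        ≡⟨ ∑ₜ-suc k (λ x → K (Vec.map merge x) * prodα F β x) ⟩
      sum (λ y → ∑ₜ k (λ xs → K (merge y ∷ Vec.map merge xs) * (β y * prodα F β xs)))
        ≈⟨ sum-cong-≋ (λ y → trans (∑ₜ-cong k (λ xs → x∙yz≈y∙xz _ _ _)) (sym (*-distribˡ-∑ₜ k (β y) _))) ⟩
      sum (λ y → β y * ∑ₜ k (λ xs → K (merge y ∷ Vec.map merge xs) * prodα F β xs))
        ≈⟨ sum-cong-≋ (λ y → *-congˡ (∑ₜ-merge k (λ x̂s → K (merge y ∷ x̂s)) β)) ⟩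
      sum (λ y → β y * H (merge y))
        ≈⟨ sum-merge β H ⟩
      sum (λ y → β* y * H y)
        ≈⟨ sum-cong-≋ (λ y → trans (*-distribˡ-∑ₜ k (β* y) _) (∑ₜ-cong k (λ x̂s → x∙yz≈y∙xz _ _ _))) ⟩
      sum (λ y → ∑ₜ k (λ x̂s → K (y ∷ x̂s) * (β* y * prodα F β* x̂s)))
        ≡⟨ ∑ₜ-suc k (λ x̂ → K x̂ * prodα F β* x̂) ⟨
      ∑ₜ (suc k) (λ x̂ → K x̂ * prodα F β* x̂)
        ∎
      where
      β* = collapse β (β a + β b)
      H : Fin n → Carrier
      H z = ∑ₜ k (λ x̂s → K (z ∷ x̂s) * prodα F β* x̂s)

    ∑ₜ-merge-collapse : ∀ k (K : Vec (Fin n) k → Carrier) {β₀ β w} → (∀ j → j ≢ a → j ≢ b → β j ≈ β₀ j) →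
                        β a + β b ≈ w →
                        ∑ₜ k (λ x → K (Vec.map merge x) * prodα F β x)
                          ≈ ∑ₜ k (λ x̂ → K x̂ * prodα F (collapse β₀ w) x̂)
    ∑ₜ-merge-collapse k K {β = β} β≈β₀ pair≈w = trans (∑ₜ-merge k K β)
      (∑ₜ-cong k (λ x̂ → *-congˡ (prodα-cong (collapse-cong β≈β₀ pair≈w) x̂)))

  module Weighted (τ : ℕ → Carrier) (τ-antitone : ∀ m → τ (suc m) ≤ τ m) where

    weighted : ∀ {n} k → (Fin n → Carrier) → Carrier
    weighted k β = ∑ₜ k (λ x → τ (distinct x) * prodα F β x)

    weighted-cong : ∀ {n} k {β β′ : Fin n → Carrier} → (∀ j → β j ≈ β′ j) → weighted k β ≈ weighted k β′
    weighted-cong k β≈β′ = ∑ₜ-cong k (λ x → *-congˡ (prodα-cong β≈β′ x))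

    weighted-const : ∀ {n} k μ → weighted {n} k (λ _ → μ) ≈ μ ^ k * ∑ₜ k (λ x → τ (distinct x))
    weighted-const k μ = begin-equality
      weighted k (λ _ → μ)                 ≈⟨ ∑ₜ-cong k (λ x → trans (*-congˡ (prodα-const μ x)) (*-comm _ _)) ⟩
      ∑ₜ k (λ x → μ ^ k * τ (distinct x))  ≈⟨ *-distribˡ-∑ₜ k (μ ^ k) _ ⟨
      μ ^ k * ∑ₜ k (λ x → τ (distinct x))  ∎

    Δ : ℕ → Carrier
    Δ m = τ m - τ (suc m)

    Δ-nonneg : ∀ m → 0# ≤ Δ m
    Δ-nonneg m = x≤y⇒0≤y-x (τ-antitone m)

    τ≈τ+Δ : ∀ m → τ m ≈ τ (suc m) + Δ m
    τ≈τ+Δ m = trans (sym ([y-x]+x≈y (τ (suc m)) (τ m))) (+-comm _ _)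

    τ-step : ∀ p q m P → τ (m ℕ.+ indicator (p ∧ q)) * P + Δ m * zeroIf q (zeroIf p P)
                         ≈ τ (suc m) * P + Δ m * (zeroIf q P + zeroIf p P)
    τ-step true  true  m P rewrite ℕₚ.+-comm m 1 =
      solve 3 (λ T D P → T :* P :+ D :* con 0 := T :* P :+ D :* (con 0 :+ con 0)) refl (τ (suc m)) (Δ m) P
    τ-step true  false m P rewrite ℕₚ.+-identityʳ m = trans (+-congʳ (*-congʳ (τ≈τ+Δ m)))
      (solve 3 (λ T D P → (T :+ D) :* P :+ D :* con 0 := T :* P :+ D :* (P :+ con 0)) refl (τ (suc m)) (Δ m) P)
    τ-step false true  m P rewrite ℕₚ.+-identityʳ m = trans (+-congʳ (*-congʳ (τ≈τ+Δ m)))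
      (solve 3 (λ T D P → (T :+ D) :* P :+ D :* con 0 := T :* P :+ D :* (con 0 :+ P)) refl (τ (suc m)) (Δ m) P)
    τ-step false false m P rewrite ℕₚ.+-identityʳ m = trans (+-congʳ (*-congʳ (τ≈τ+Δ m)))
      (solve 3 (λ T D P → (T :+ D) :* P :+ D :* P := T :* P :+ D :* (P :+ P)) refl (τ (suc m)) (Δ m) P)

    module _ {n : ℕ} {a b : Fin n} (a≢b : a ≢ b) where
      open Collapse a≢b

      mergedDistinct : ∀ {k} → Vec (Fin n) k → ℕ
      mergedDistinct x = distinct (Vec.map merge x)

      -- The identity τ(m + 1) + Δ m = τ m turns [not both a and b occur] into the weight Δ m, and
      -- inclusion–exclusion writes [not both occur] · ∏β as ∏β[b↦0] + ∏β[a↦0] − ∏β[a,b↦0].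
      tuple-identity : ∀ {k} β (x : Vec (Fin n) k) →
        τ (distinct x) * prodα F β x + Δ (mergedDistinct x) * prodα F (zeroAt₂ a≢b β) x
          ≈ τ (suc (mergedDistinct x)) * prodα F β x
            + Δ (mergedDistinct x) * (prodα F (zeroAt b β) x + prodα F (zeroAt a β) x)
      tuple-identity β x = begin-equality
        τ (distinct x) * P + Δ m * prodα F (zeroAt₂ a≢b β) x
          ≡⟨ ≡.cong (λ d → τ d * P + Δ m * prodα F (zeroAt₂ a≢b β) x) (distinct-merge x) ⟩
        τ (m ℕ.+ indicator (p ∧ q)) * P + Δ m * prodα F (zeroAt₂ a≢b β) x
          ≈⟨ +-congˡ (*-congˡ (trans (prodα-zeroAt b (zeroAt a β) x) (zeroIf-cong q (prodα-zeroAt a β x)))) ⟩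
        τ (m ℕ.+ indicator (p ∧ q)) * P + Δ m * zeroIf q (zeroIf p P)
          ≈⟨ τ-step p q m P ⟩
        τ (suc m) * P + Δ m * (zeroIf q P + zeroIf p P)
          ≈⟨ +-congˡ (*-congˡ (+-cong (prodα-zeroAt b β x) (prodα-zeroAt a β x))) ⟨
        τ (suc m) * P + Δ m * (prodα F (zeroAt b β) x + prodα F (zeroAt a β) x)
          ∎
        where
        P = prodα F β x
        m = mergedDistinct x
        p = occurs (toList x) a
        q = occurs (toList x) b

      module _ (k : ℕ) (β₀ : Fin n → Carrier) where

        collapsed : (Vec (Fin n) k → Carrier) → Carrier → Carrier
        collapsed K w = ∑ₜ k (λ x̂ → K x̂ * prodα F (collapse β₀ w) x̂)

        weighted-collapse : ∀ {β} → (∀ j → j ≢ a → j ≢ b → β j ≈ β₀ j) →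
          weighted k β + collapsed (Δ ∘ distinct) 0#
            ≈ collapsed (τ ∘ suc ∘ distinct) (β a + β b)
              + (collapsed (Δ ∘ distinct) (β a) + collapsed (Δ ∘ distinct) (β b))
        weighted-collapse {β} β≈β₀ = begin-equality
          weighted k β + collapsed KΔ 0#
            ≈⟨ +-congˡ (∑ₜ-merge-collapse k KΔ (off (zeroAt₂ a≢b β) (zeroAt₂-off a≢b β)) zeroAt₂-pair) ⟨
          weighted k β + ∑ₜ k (λ x → Δ (m̂ x) * P (zeroAt₂ a≢b β) x)
            ≈⟨ ∑ₜ-distrib-+ k _ _ ⟨
          ∑ₜ k (λ x → τ (distinct x) * P β x + Δ (m̂ x) * P (zeroAt₂ a≢b β) x)
            ≈⟨ ∑ₜ-cong k (tuple-identity β) ⟩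
          ∑ₜ k (λ x → τ (suc (m̂ x)) * P β x + Δ (m̂ x) * (P (zeroAt b β) x + P (zeroAt a β) x))
            ≈⟨ trans (∑ₜ-distrib-+ k _ _) (+-congˡ (∑ₜ-distrib-*-+ k (Δ ∘ m̂) _ _)) ⟩
          ∑ₜ k (λ x → τ (suc (m̂ x)) * P β x)
            + (∑ₜ k (λ x → Δ (m̂ x) * P (zeroAt b β) x) + ∑ₜ k (λ x → Δ (m̂ x) * P (zeroAt a β) x))
            ≈⟨ +-cong (∑ₜ-merge-collapse k Kτ β≈β₀ refl)
                      (+-cong (∑ₜ-merge-collapse k KΔ (off (zeroAt b β) (λ _ → updateAt-minimal _ b β)) b-zeroed)
                              (∑ₜ-merge-collapse k KΔ (off (zeroAt a β) (λ j≢a _ → updateAt-minimal _ a β j≢a))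
                                                 a-zeroed)) ⟩
          collapsed Kτ (β a + β b) + (collapsed KΔ (β a) + collapsed KΔ (β b))
            ∎
          where
          Kτ KΔ : Vec (Fin n) k → Carrier
          Kτ = τ ∘ suc ∘ distinct
          KΔ = Δ ∘ distinct
          P = prodα F
          m̂ = mergedDistinct
          off : ∀ β′ → (∀ {j} → j ≢ a → j ≢ b → β′ j ≡ β j) → ∀ j → j ≢ a → j ≢ b → β′ j ≈ β₀ j
          off β′ β′≡β j j≢a j≢b = trans (reflexive (β′≡β j≢a j≢b)) (β≈β₀ j j≢a j≢b)
          zeroAt₂-pair : zeroAt₂ a≢b β a + zeroAt₂ a≢b β b ≈ 0#
          zeroAt₂-pair = trans (reflexive (≡.cong₂ _+_ (zeroAt₂-a a≢b β) (zeroAt₂-b a≢b β))) (+-identityˡ 0#)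
          b-zeroed : zeroAt b β a + zeroAt b β b ≈ β a
          b-zeroed = trans (reflexive (≡.cong₂ _+_ (updateAt-minimal a b β a≢b) (updateAt-updates b β)))
                           (+-identityʳ (β a))
          a-zeroed : zeroAt a β a + zeroAt a β b ≈ β b
          a-zeroed = trans (reflexive (≡.cong₂ _+_ (updateAt-updates a β)
                                                   (updateAt-minimal b a β (λ b≡a → a≢b (≡.sym b≡a)))))
                           (+-identityˡ (β b))

        collapsed-cong : ∀ K {w w′} → w ≈ w′ → collapsed K w ≈ collapsed K w′
        collapsed-cong K w≈w′ =
          ∑ₜ-cong k (λ x̂ → *-congˡ (prodα-cong (collapse-cong (λ _ _ _ → refl) w≈w′) x̂))

      weighted-transfer : ∀ k {β β′} → (∀ j → 0# ≤ β j) → (∀ j → j ≢ a → j ≢ b → β′ j ≈ β j) →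
                          β a ≤ β′ a → β a ≤ β′ b → β′ a + β′ b ≈ β a + β b → weighted k β′ ≤ weighted k β
      weighted-transfer k {β} {β′} 0≤β β′≈β βa≤β′a βa≤β′b pair≈ = +-cancelʳ-≤ (D 0#) (begin
        weighted k β′ + D 0#                      ≈⟨ weighted-collapse k β β′≈β ⟩
        C (β′ a + β′ b) + (D (β′ a) + D (β′ b))  ≤⟨ +-mono-≤ (≤-reflexive (collapsed-cong k β _ pair≈)) spread ⟩
        C (β a + β b) + (D (β a) + D (β b))      ≈⟨ weighted-collapse k β (λ _ _ _ → refl) ⟨
        weighted k β + D 0#                       ∎)
        where
        C D : Carrier → Carrier
        C = collapsed k β (τ ∘ suc ∘ distinct)
        D = collapsed k β (Δ ∘ distinct)
        P : Carrier → Vec (Fin n) k → Carrier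
        P w = prodα F (collapse β w)
        P-spread : ∀ x̂ → P (β′ a) x̂ + P (β′ b) x̂ ≤ P (β a) x̂ + P (β b) x̂
        P-spread x̂ = begin
          P (β′ a) x̂ + P (β′ b) x̂      ≈⟨ +-cong (prodα-collapse β (β′ a) x̂) (prodα-collapse β (β′ b) x̂) ⟩
          β′ a ^ r * R + β′ b ^ r * R  ≈⟨ distribʳ R _ _ ⟨
          (β′ a ^ r + β′ b ^ r) * R    ≤⟨ *-monoʳ-≤ (prodα-nonneg (collapse-nonneg 0≤β 0≤1) x̂)
                                            (^+^-spread (0≤β a) βa≤β′a βa≤β′b pair≈ r) ⟩
          (β a ^ r + β b ^ r) * R      ≈⟨ distribʳ R _ _ ⟩
          β a ^ r * R + β b ^ r * R    ≈⟨ +-cong (prodα-collapse β (β a) x̂) (prodα-collapse β (β b) x̂) ⟨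
          P (β a) x̂ + P (β b) x̂        ∎
          where
          r = Vec.count (_≟ a) x̂
          R = prodα F (collapse β 1#) x̂
        spread : D (β′ a) + D (β′ b) ≤ D (β a) + D (β b)
        spread = begin
          D (β′ a) + D (β′ b)
            ≈⟨ ∑ₜ-distrib-*-+ k _ _ _ ⟨
          ∑ₜ k (λ x̂ → Δ (distinct x̂) * (P (β′ a) x̂ + P (β′ b) x̂))
            ≤⟨ ∑ₜ-mono-≤ k (λ x̂ → *-monoˡ-≤ (Δ-nonneg _) (P-spread x̂)) ⟩
          ∑ₜ k (λ x̂ → Δ (distinct x̂) * (P (β a) x̂ + P (β b) x̂))
            ≈⟨ ∑ₜ-distrib-*-+ k _ _ _ ⟩
          D (β a) + D (β b)
            ∎

    module Smoothing {n : ℕ} (k : ℕ) (μ : Carrier) where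
      open DecMembership (_≟_ {n}) using (_∈?_)

      record AlmostUniform (U : List (Fin n)) (β : Fin n → Carrier) : Set (c ⊔ ℓ₁ ⊔ ℓ₂) where
        field
          nonneg      : ∀ j → 0# ≤ β j
          sum≈        : sum β ≈ sum {n} (λ _ → μ)
          uniform-off : ∀ j → j ∉ U → β j ≈ μ
      open AlmostUniform

      uniform-below : ∀ {U β} → AlmostUniform U β → (∀ j → j ∈ U → β j ≤ μ) → ∀ j → β j ≈ μ
      uniform-below {U} {β} au below = sum-≤-≈⇒≈ β≤μ (sum≈ au)
        where
        β≤μ : ∀ j → β j ≤ μ
        β≤μ j with j ∈? U
        ... | yes j∈U = below j j∈U
        ... | no j∉U  = ≤-reflexive (uniform-off au j j∉U)

      uniform-above : ∀ {U β} → AlmostUniform U β → (∀ j → j ∈ U → μ ≤ β j) → ∀ j → β j ≈ μ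
      uniform-above {U} {β} au above j = sym (sum-≤-≈⇒≈ μ≤β (sym (sum≈ au)) j)
        where
        μ≤β : ∀ j → μ ≤ β j
        μ≤β j with j ∈? U
        ... | yes j∈U = above j j∈U
        ... | no j∉U  = ≤-reflexive (sym (uniform-off au j j∉U))

      keep : ∀ {c U β} → AlmostUniform (c ∷ U) β → β c ≈ μ → AlmostUniform U β
      keep {c} {U} {β} au βc≈μ = record { nonneg = nonneg au ; sum≈ = sum≈ au ; uniform-off = off }
        where
        off : ∀ j → j ∉ U → β j ≈ μ
        off j j∉U with j ≟ c
        ... | yes ≡.refl = βc≈μ
        ... | no j≢c     = uniform-off au j (λ { (here j≡c) → j≢c j≡c ; (there j∈U) → j∉U j∈U })

      Between : Carrier → Carrier → Set ℓ₂
      Between x y = (x ≤ μ × μ ≤ y) ⊎ (y ≤ μ × μ ≤ x)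

      rebalance : Fin n → Fin n → (Fin n → Carrier) → Fin n → Carrier
      rebalance c d β j = if does (j ≟ c) then μ else if does (j ≟ d) then (β c + β d) - μ else β j

      module _ {c d : Fin n} (c≢d : c ≢ d) (β : Fin n → Carrier) where

        rebalance-off : ∀ j → j ≢ c → j ≢ d → rebalance c d β j ≈ β j
        rebalance-off j j≢c j≢d rewrite dec-false (j ≟ c) j≢c | dec-false (j ≟ d) j≢d = refl

        rebalance-c : rebalance c d β c ≈ μ
        rebalance-c rewrite dec-true (c ≟ c) ≡.refl = refl

        rebalance-d : rebalance c d β d ≈ (β c + β d) - μ
        rebalance-d rewrite dec-false (d ≟ c) (λ d≡c → c≢d (≡.sym d≡c)) | dec-true (d ≟ d) ≡.refl = refl

        rebalance-pair : rebalance c d β c + rebalance c d β d ≈ β c + β d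
        rebalance-pair = trans (+-cong rebalance-c rebalance-d) (trans (+-comm μ _) ([y-x]+x≈y μ (β c + β d)))

        rebalance-≤ : (∀ j → 0# ≤ β j) → Between (β c) (β d) → weighted k (rebalance c d β) ≤ weighted k β
        rebalance-≤ 0≤β (inj₁ (βc≤μ , μ≤βd)) = weighted-transfer c≢d k 0≤β rebalance-off
          (≤-respʳ-≈ (sym rebalance-c) βc≤μ) (≤-respʳ-≈ (sym rebalance-d) (x≤[x+y]-z (β c) μ≤βd)) rebalance-pair
        rebalance-≤ 0≤β (inj₂ (βd≤μ , μ≤βc)) = weighted-transfer (λ d≡c → c≢d (≡.sym d≡c)) k 0≤β
          (λ j j≢d j≢c → rebalance-off j j≢c j≢d)
          (≤-respʳ-≈ (sym (trans rebalance-d (+-congʳ (+-comm (β c) (β d))))) (x≤[x+y]-z (β d) μ≤βc))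
          (≤-respʳ-≈ (sym rebalance-c) βd≤μ)
          (trans (+-comm _ _) (trans rebalance-pair (+-comm (β c) (β d))))

      rebalance-uniform : ∀ {c d U β} → AlmostUniform (c ∷ U) β → d ∈ U → c ≢ d → Between (β c) (β d) →
                          AlmostUniform U (rebalance c d β)
      rebalance-uniform {c} {d} {U} {β} au d∈U c≢d between = record
        { nonneg      = nonneg′
        ; sum≈        = trans (sum-pair c≢d (rebalance-off c≢d β) (rebalance-pair c≢d β)) (sum≈ au)
        ; uniform-off = off
        }
        where
        bounds : Between (β c) (β d) → 0# ≤ μ × μ ≤ β c + β d
        bounds (inj₁ (βc≤μ , μ≤βd)) = ≤-trans (nonneg au c) βc≤μ ,
          ≤-trans μ≤βd (≤-respʳ-≈ (+-comm (β d) (β c)) (x≤x+y (β d) (nonneg au c)))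
        bounds (inj₂ (βd≤μ , μ≤βc)) = ≤-trans (nonneg au d) βd≤μ , ≤-trans μ≤βc (x≤x+y (β c) (nonneg au d))
        0≤μ≤βc+βd : 0# ≤ μ × μ ≤ β c + β d
        0≤μ≤βc+βd = bounds between
        nonneg′ : ∀ j → 0# ≤ rebalance c d β j
        nonneg′ j with does (j ≟ c) | does (j ≟ d)
        ... | true  | _     = proj₁ 0≤μ≤βc+βd
        ... | false | true  = x≤y⇒0≤y-x (proj₂ 0≤μ≤βc+βd)
        ... | false | false = nonneg au j
        off : ∀ j → j ∉ U → rebalance c d β j ≈ μ
        off j j∉U with j ≟ c | j ≟ d
        ... | yes _   | _          = refl
        ... | no _    | yes ≡.refl = ⊥-elim (j∉U d∈U)
        ... | no j≢c  | no _       = uniform-off au j (λ { (here j≡c) → j≢c j≡c ; (there j∈U) → j∉U j∈U })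

      between-self : ∀ {x} → Between x x → x ≈ μ
      between-self (inj₁ (x≤μ , μ≤x)) = antisym x≤μ μ≤x
      between-self (inj₂ (x≤μ , μ≤x)) = antisym x≤μ μ≤x

      Settled : List (Fin n) → (Fin n → Carrier) → Set (c ⊔ ℓ₁ ⊔ ℓ₂)
      Settled U β = Σ[ β′ ∈ (Fin n → Carrier) ] AlmostUniform U β′ × weighted k β′ ≤ weighted k β

      settle-with : ∀ {c d U β} → AlmostUniform (c ∷ U) β → d ∈ U → Between (β c) (β d) → Settled U β
      settle-with {c} {d} {U} {β} au d∈U between with c ≟ d
      ... | yes ≡.refl = β , keep au (between-self between) , ≤-refl
      ... | no c≢d     = rebalance c d β , rebalance-uniform au d∈U c≢d between ,
                         rebalance-≤ c≢d β (nonneg au) between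

      -- If all of U lies on the same side of μ as β c, equal totals force β c ≈ μ; otherwise some
      -- d ∈ U lies on the other side, and c is rebalanced against d.
      settle : ∀ {c U β} → AlmostUniform (c ∷ U) β → Settled U β
      settle {c} {U} {β} au with total (β c) μ
      ... | inj₁ βc≤μ with All.decide (λ j → total (β j) μ) U
      ...   | inj₁ U≤μ = β , keep au (uniform-below au below c) , ≤-refl
        where
        below : ∀ j → j ∈ c ∷ U → β j ≤ μ
        below j (here ≡.refl) = βc≤μ
        below j (there j∈U)   = All.lookup U≤μ j∈U
      ...   | inj₂ U≥μ with find U≥μ
      ...     | d , d∈U , μ≤βd = settle-with au d∈U (inj₁ (βc≤μ , μ≤βd))
      settle {c} {U} {β} au | inj₂ μ≤βc with All.decide (λ j → Sum.swap (total (β j) μ)) U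
      ...   | inj₁ U≥μ = β , keep au (uniform-above au above c) , ≤-refl
        where
        above : ∀ j → j ∈ c ∷ U → μ ≤ β j
        above j (here ≡.refl) = μ≤βc
        above j (there j∈U)   = All.lookup U≥μ j∈U
      ...   | inj₂ U≤μ with find U≤μ
      ...     | d , d∈U , βd≤μ = settle-with au d∈U (inj₂ (βd≤μ , μ≤βc))

      uniform-≤ : ∀ U {β} → AlmostUniform U β → weighted {n} k (λ _ → μ) ≤ weighted k β
      uniform-≤ []      au = ≤-reflexive (weighted-cong k (λ j → sym (uniform-off au j (λ ()))))
      uniform-≤ (c ∷ U) au with settle au
      ... | β′ , au′ , β′≤β = ≤-trans (uniform-≤ U au′) β′≤β

    sum^k*∑τ≤n^k*weighted : ∀ {n} k (α : Fin n → Carrier) → (∀ j → 0# ≤ α j) →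
                sum α ^ k * ∑ₜ k (λ x → τ (distinct x)) ≤ fromℕ F n ^ k * weighted k α
    sum^k*∑τ≤n^k*weighted {n} k α 0≤α = begin
      sum α ^ k * Sτ                  ≈⟨ *-congʳ (^-congˡ k (sym Nμ≈sumα)) ⟩
      (N * μ) ^ k * Sτ                ≈⟨ *-congʳ (^-distrib-* N μ k) ⟩
      (N ^ k * μ ^ k) * Sτ            ≈⟨ *-assoc _ _ _ ⟩
      N ^ k * (μ ^ k * Sτ)            ≈⟨ *-congˡ (weighted-const k μ) ⟨
      N ^ k * weighted k (λ _ → μ)    ≤⟨ *-monoˡ-≤ (^-nonneg (fromℕ-nonneg n) k)
                                                   (Smoothing.uniform-≤ k μ (allFin n) almostUniform) ⟩
      N ^ k * weighted k α            ∎
      where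
      N = fromℕ F n
      Sτ = ∑ₜ k (λ x → τ (distinct x))
      μ = proj₁ (∃-mean n α)
      Nμ≈sumα = proj₂ (∃-mean n α)
      almostUniform : Smoothing.AlmostUniform k μ (allFin n) α
      almostUniform = record
        { nonneg      = 0≤α
        ; sum≈        = trans (sym Nμ≈sumα) (sym (sum-const n μ))
        ; uniform-off = λ j j∉ → ⊥-elim (j∉ (∈-allFin j))
        }

    𝔼τ*𝔼α≤𝔼τα-nonempty : ∀ {n} k (α : Fin n → Carrier) → (∀ j → 0# ≤ α j) → n ℕ.^ k ≢ 0 →
      𝔼 F n k (λ x → τ (distinct x)) * 𝔼 F n k (prodα F α) ≤ 𝔼 F n k (λ x → τ (distinct x) * prodα F α x)
    -- Multiplying by i * i ≥ 0 avoids determining the sign of i = N ⁻¹.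
    𝔼τ*𝔼α≤𝔼τα-nonempty {n} k α 0≤α n^k≢0 = begin
      (Sτ * i) * (Sα * i)               ≈⟨ solve 3 (λ t a i → (t :* i) :* (a :* i) := (a :* t) :* (i :* i))
                                                   refl Sτ Sα i ⟩
      (Sα * Sτ) * (i * i)               ≈⟨ *-congʳ (*-congʳ (∑ₜ-prodα k α)) ⟩
      (sum α ^ k * Sτ) * (i * i)        ≤⟨ *-monoʳ-≤ (x*x-nonneg i) (sum^k*∑τ≤n^k*weighted k α 0≤α) ⟩
      (fromℕ F n ^ k * W) * (i * i)     ≈⟨ *-congʳ (*-congʳ (fromℕ-^ n k)) ⟨
      (N * W) * (i * i)                 ≈⟨ solve 3 (λ N W i → (N :* W) :* (i :* i) := (W :* i) :* (N :* i))
                                                   refl N W i ⟩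
      (W * i) * (N * i)                 ≈⟨ *-congˡ (⁻¹-inverse N (fromℕ≉0 n^k≢0)) ⟩
      (W * i) * 1#                      ≈⟨ *-identityʳ (W * i) ⟩
      W * i                             ∎
      where
      N = fromℕ F (n ℕ.^ k)
      i = N ⁻¹
      Sτ = ∑ₜ k (λ x → τ (distinct x))
      Sα = ∑ₜ k (prodα F α)
      W = weighted k α

    𝔼τ*𝔼α≤𝔼τα : ∀ n (α : Fin n → Carrier) → (∀ j → 0# ≤ α j) → ∀ k →
      𝔼 F n k (λ x → τ (distinct x)) * 𝔼 F n k (prodα F α) ≤ 𝔼 F n k (λ x → τ (distinct x) * prodα F α x)
    -- D^k is empty: every expectation is 0# * 0 ⁻¹ (a junk inverse), hence ≈ 0#.
    𝔼τ*𝔼α≤𝔼τα zero    α 0≤α (suc k) =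
      ≤-reflexive (trans (*-congʳ (zeroˡ i)) (trans (zeroˡ (0# * i)) (sym (zeroˡ i))))
      where i = fromℕ F 0 ⁻¹
    𝔼τ*𝔼α≤𝔼τα zero    α 0≤α zero    = 𝔼τ*𝔼α≤𝔼τα-nonempty zero α 0≤α (λ ())
    𝔼τ*𝔼α≤𝔼τα (suc n) α 0≤α k       =
      𝔼τ*𝔼α≤𝔼τα-nonempty k α 0≤α (λ n^k≡0 → ℕₚ.1+n≢0 (ℕₚ.m^n≡0⇒m≡0 (suc n) k n^k≡0))

corollary4p5 : ∀ {c ℓ₁ ℓ₂} (F : OrderedField c ℓ₁ ℓ₂) →
    let open OrderedField F in
    (n : ℕ) (t : Carrier) → 1# ≤ t →
    (α : Fin n → Carrier) → (∀ x → 0# ≤ α x) →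
    (τ : ℕ → Carrier) → (∀ m → 0# ≤ τ m) →
    (∀ m m′ → m Data.Nat.≤ m′ → τ m′ ≤ τ m) →
    (k : ℕ) →
    𝔼 F n k (λ x → τ (distinct x)) * 𝔼 F n k (prodα F α)
      ≤ 𝔼 F n k (λ x → τ (distinct x) * prodα F α x)
corollary4p5 F n _ _ α 0≤α τ _ τ-antitone k =
  OrderedFieldProperties.Weighted.𝔼τ*𝔼α≤𝔼τα F τ (λ m → τ-antitone m (suc m) (ℕₚ.n≤1+n m)) n α 0≤α k
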